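{- A $2$-reductive solution $(X,\sigma,\tau)$ satisfies $\sigma_x=\tau_x^{ -1}$ for all $x\in X$ if and only if it is involutive, i.e. $r^2=\mathrm{id}_{X^2}$.
   Context: A solution is a triple $(X,\sigma,\tau)$ with $X$ a non-empty set and bijections $\sigma_x,\tau_y$ of $X$ such that $r(x,y)=(\sigma_x(y),\tau_y(x))$ is a bijection of $X^2$ satisfying $(\mathrm{id}\times r)(r\times\mathrm{id})(\mathrm{id}\times r)=(r\times\mathrm{id})(\mathrm{id}\times r)(r\times\mathrm{id})$. It is $2$-reductive if for all $x,y$: $\sigma_{\sigma_x(y)}=\sigma_y$, $\tau_{\tau_x(y)}=\tau_y$, $\sigma_{\tau_x(y)}=\sigma_y$, $\tau_{\sigma_x(y)}=\tau_y$. -}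

module Defs where

open import Level using (Level; suc)
open import Data.Product using (_×_; _,_; proj₁; proj₂)
open import Function using (_↔_; Inverse; _∘_)
open import Function.Definitions using (Bijective)
open import Relation.Binary.PropositionalEquality using (_≡_)

rmap : ∀ {a} {X : Set a} → (X → X → X) → (X → X → X) → X × X → X × X
rmap s t (x , y) = (s x y , t y x)

Triple : ∀ {a} → Set a → Set a
Triple X = X × X × X

r×id : ∀ {a} {X : Set a} → (X × X → X × X) → Triple X → Triple X
r×id r (x , y , z) = (proj₁ (r (x , y)) , proj₂ (r (x , y)) , z)

id×r : ∀ {a} {X : Set a} → (X × X → X × X) → Triple X → Triple X
id×r r (x , y , z) = (x , proj₁ (r (y , z)) , proj₂ (r (y , z)))

record Solution {a} (X : Set a) : Set a where
  field
    inhabitant : X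
    σ : X → X ↔ X
    τ : X → X ↔ X
  σf : X → X → X
  σf x = Inverse.to (σ x)
  τf : X → X → X
  τf x = Inverse.to (τ x)
  r : X × X → X × X
  r = rmap σf τf
  field
    r-bijective : Bijective _≡_ _≡_ r
    braid : ∀ t → id×r r (r×id r (id×r r t)) ≡ r×id r (id×r r (r×id r t))

TwoReductive : ∀ {a} {X : Set a} → Solution X → Set a
TwoReductive {X = X} S =
  (∀ x y z → σf (σf x y) z ≡ σf y z) ×
  (∀ x y z → τf (τf x y) z ≡ τf y z) ×
  (∀ x y z → σf (τf x y) z ≡ σf y z) ×
  (∀ x y z → τf (σf x y) z ≡ τf y z)
  where open Solution S

Involutive : ∀ {a} {X : Set a} → Solution X → Set a
Involutive S = ∀ p → r (r p) ≡ p
  where open Solution S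

SigmaIsTauInverse : ∀ {a} {X : Set a} → Solution X → Set a
SigmaIsTauInverse S = ∀ x y → σf x y ≡ Inverse.from (τ x) y
  where open Solution S

{-# OPTIONS --safe #-}
-- Using σ_{σ_x(y)} = σ_y and τ_{τ_x(y)} = τ_y, the square of r collapses to
-- r²(x, y) = (σ_y(τ_y(x)), τ_x(σ_x(y))). So r² = id says exactly that σ_y ∘ τ_y
-- and τ_x ∘ σ_x are the identity, i.e. σ_x = τ_x⁻¹.
module Submission where

open import Defs
open import Function using (_⇔_; mk⇔; Inverse)
open import Data.Product using (_,_; proj₁; proj₂)
open import Relation.Binary.PropositionalEquality

module _ {a} {X : Set a} (S : Solution X) where
  open Solution S

  r²≡ : (∀ x y z → σf (σf x y) z ≡ σf y z) → (∀ x y z → τf (τf x y) z ≡ τf y z) →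
        ∀ x y → r (r (x , y)) ≡ (σf y (τf y x) , τf x (σf x y))
  r²≡ σσ ττ x y = cong₂ _,_ (σσ x y (τf y x)) (ττ y x (σf x y))

  module _ (reductive : TwoReductive S) where
    private
      r²-reduced : ∀ x y → r (r (x , y)) ≡ (σf y (τf y x) , τf x (σf x y))
      r²-reduced = r²≡ (proj₁ reductive) (proj₁ (proj₂ reductive))

    sigmaIsTauInverse⇒involutive : SigmaIsTauInverse S → Involutive S
    sigmaIsTauInverse⇒involutive σ≡τ⁻¹ (x , y) = begin
      r (r (x , y))                                             ≡⟨ r²-reduced x y ⟩
      σf y (τf y x) , τf x (σf x y)                             ≡⟨ cong₂ _,_ (σ≡τ⁻¹ y (τf y x)) (cong (τf x) (σ≡τ⁻¹ x y)) ⟩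
      Inverse.from (τ y) (τf y x) , τf x (Inverse.from (τ x) y) ≡⟨ cong₂ _,_ (Inverse.strictlyInverseʳ (τ y) x) (Inverse.strictlyInverseˡ (τ x) y) ⟩
      x , y                                                     ∎
      where open ≡-Reasoning

    involutive⇒sigmaIsTauInverse : Involutive S → SigmaIsTauInverse S
    involutive⇒sigmaIsTauInverse involutive x y = begin
      σf x y                ≡⟨ cong (σf x) (sym (Inverse.strictlyInverseˡ (τ x) y)) ⟩
      σf x (τf x z)         ≡⟨ cong proj₁ (sym (r²-reduced z x)) ⟩
      proj₁ (r (r (z , x))) ≡⟨ cong proj₁ (involutive (z , x)) ⟩
      z                     ∎
      where
      open ≡-Reasoning
      z : X
      z = Inverse.from (τ x) y

lemma3p6 : ∀ {a} {X : Set a} (S : Solution X) → TwoReductive S →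
    (SigmaIsTauInverse S ⇔ Involutive S)
lemma3p6 S reductive =
  mk⇔ (sigmaIsTauInverse⇒involutive S reductive) (involutive⇒sigmaIsTauInverse S reductive)
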